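{- Let $I\subseteq\mathbb Z$ be a finite interval and let $T,V\ge1$ be integers with $TV\le\lvert I\rvert$. Then there exists a partition $\mathcal P$ of $I$ such that for every $P\in\mathcal P$: (1) $P=(T\mathbb Z+a)\cap[x,y]$ for some $(a,x,y)\in\mathbb Z\times I\times I$, and (2) $V/2\le\lvert P\rvert\le V$.
   Context: $\lvert I\rvert$ denotes the number of integers in $I$. -}

module Defs where

open import Data.Nat using (ℕ)
open import Data.Integer using (ℤ; +_; _+_; _-_; _≤_; _<_)
open import Data.Integer.Divisibility using (_∣_)
open import Data.List using (List; length; lookup)
open import Data.List.Membership.Propositional using (_∈_)
open import Data.List.Relation.Unary.Any using (Any)
open import Data.List.Relation.Unary.Unique.Propositional using (Unique)
open import Data.Fin using (Fin)
open import Data.Product using (_×_; ∃-syntax)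
open import Relation.Binary.PropositionalEquality using (_≢_)
open import Relation.Nullary using (¬_)
open import Function.Bundles using (_⇔_)

InInterval : ℤ → ℕ → ℤ → Set
InInterval lo n z = (lo ≤ z) × (z < lo + + n)

InAPSegment : ℕ → ℤ → ℤ → ℤ → ℤ → Set
InAPSegment T a x y z = (x ≤ z) × (z ≤ y) × (+ T ∣ z - a)

-- A finite set of integers is represented by a duplicate-free list;
-- its cardinality is the length of the list.
record IsPartitionOf (lo : ℤ) (n : ℕ) (Ps : List (List ℤ)) : Set where
  field
    blocks-unique : ∀ (i : Fin (length Ps)) → Unique (lookup Ps i)
    blocks-nonempty : ∀ (i : Fin (length Ps)) → ∃[ z ] (z ∈ lookup Ps i)
    disjoint : ∀ (i j : Fin (length Ps)) → i ≢ j →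
               ∀ z → z ∈ lookup Ps i → ¬ (z ∈ lookup Ps j)
    covers : ∀ z → InInterval lo n z ⇔ Any (z ∈_) Ps

IsAPBlock : ℤ → ℕ → ℕ → List ℤ → Set
IsAPBlock lo n T P =
  ∃[ a ] ∃[ x ] ∃[ y ] (InInterval lo n x × InInterval lo n y ×
    (∀ z → (z ∈ P) ⇔ InAPSegment T a x y z))

module Submission where

-- Translate I to [0, n) by z ↦ z − lo. There the residue class of j < T is the progression
-- j, j + T, j + 2T, …, and it has at least V terms because TV ≤ n. Cut every class into runs of
-- consecutive terms whose lengths c lie in [⌈V/2⌉, 2⌈V/2⌉), i.e. V ≤ 2c and c ≤ V: all runs have
-- length ⌈V/2⌉ except the first, which also takes the remainder. A run with first term x and last
-- term y is exactly (TZ + x) ∩ [x, y], so shifting the runs back by lo gives the partition.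

open import Defs
open import Data.Nat using (ℕ; _*_; _≤_)
open import Data.Integer using (ℤ)
open import Data.List using (List; length; lookup)
open import Data.Fin using (Fin)
import Data.Fin as Fin
open import Data.Product using (_×_; ∃-syntax)

open import Data.Nat
  using (zero; suc; _+_; _∸_; _<_; _<?_; ⌊_/2⌋; ⌈_/2⌉; NonZero; >-nonZero⁻¹; z≤n; s≤s; s≤s⁻¹; z<s; s<s)
open import Data.Nat.Properties
open import Data.Nat.DivMod using (_/_; _%_; m≡m%n+[m/n]*n; [m+kn]%n≡m%n; m<n⇒m%n≡m; m%n<n; m≥n⇒m/n>0)
open import Data.Nat.Divisibility using (divides; n∣m*n) renaming (_∣_ to _∣ℕ_)
open import Data.Nat.ListAction using (sum)
import Data.Integer as ℤ
import Data.Integer.Properties as ℤ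
open import Data.Integer.Tactic.RingSolver using (solve-∀)
open import Data.List using ([]; _∷_; _++_; map; concat; replicate; upTo)
open import Data.List.Properties using (length-map; concat-map; concat-concat; map-∘; map-cong-local)
open import Data.List.Membership.Propositional using (_∈_)
open import Data.List.Membership.Propositional.Properties
  using (∈-map⁺; ∈-map⁻; ∈-concat⁺; ∈-concat⁻; ∈-concat⁺′; ∈-concat⁻′; ∈-lookup; ∈-upTo⁺; ∈-upTo⁻)
open import Data.List.Relation.Unary.Any using (here; there)
open import Data.List.Relation.Unary.All as All using (All; []; _∷_)
import Data.List.Relation.Unary.All.Properties as All
open import Data.List.Relation.Unary.AllPairs as AllPairs using (AllPairs; []; _∷_)
import Data.List.Relation.Unary.AllPairs.Properties as AllPairs
open import Data.List.Relation.Unary.Unique.Propositional using (Unique)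
import Data.List.Relation.Unary.Unique.Propositional.Properties as Unique
open import Data.List.Relation.Binary.Disjoint.Propositional using (Disjoint)
import Data.List.Relation.Binary.Disjoint.Propositional.Properties as Disjoint
open import Data.Product using (_,_; proj₁; proj₂)
open import Data.Empty using (⊥-elim)
open import Function using (_∘_; id)
open import Function.Bundles using (_⇔_; mk⇔; Equivalence)
open import Relation.Binary.Definitions using (Symmetric)
open import Relation.Binary.PropositionalEquality
  using (_≡_; _≢_; refl; sym; trans; cong; subst; subst₂; module ≡-Reasoning)
open import Relation.Nullary using (¬_; yes; no)
open import Relation.Unary using (Decidable)

open Equivalence using (to; from)

module _ {a} {A : Set a} where

  Unique-++⁻ : ∀ (xs : List A) {ys} → Unique (xs ++ ys) → Unique xs × Unique ys × Disjoint xs ys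
  Unique-++⁻ []       u          = [] , u , λ ()
  Unique-++⁻ (x ∷ xs) (x∉ ∷ u) with Unique-++⁻ xs u
  ... | uxs , uys , xs#ys = All.++⁻ˡ xs x∉ ∷ uxs , uys , x∷xs#ys
    where
    x∷xs#ys : Disjoint (x ∷ xs) _
    x∷xs#ys (here refl , v∈ys) = All.lookup (All.++⁻ʳ xs x∉) v∈ys refl
    x∷xs#ys (there v∈xs , v∈ys) = xs#ys (v∈xs , v∈ys)

  Unique-concat⁻ : ∀ (xss : List (List A)) → Unique (concat xss) → All Unique xss × AllPairs Disjoint xss
  Unique-concat⁻ []         _ = [] , []
  Unique-concat⁻ (xs ∷ xss) u with Unique-++⁻ xs u
  ... | uxs , urest , xs#rest with Unique-concat⁻ xss urest
  ... | uxss , #xss =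
    uxs ∷ uxss , All.tabulate (λ ys∈ (v∈xs , v∈ys) → xs#rest (v∈xs , ∈-concat⁺′ v∈ys ys∈)) ∷ #xss

  AllPairs-lookup : ∀ {r} {R : A → A → Set r} → Symmetric R → ∀ {xs} → AllPairs R xs →
                    ∀ {i j} → i ≢ j → R (lookup xs i) (lookup xs j)
  AllPairs-lookup R-sym (_  ∷ _)   {Fin.zero}  {Fin.zero}  i≢j = ⊥-elim (i≢j refl)
  AllPairs-lookup R-sym (px ∷ _)   {Fin.zero}  {Fin.suc j} _   = All.lookup px (∈-lookup j)
  AllPairs-lookup R-sym (px ∷ _)   {Fin.suc i} {Fin.zero}  _   = R-sym (All.lookup px (∈-lookup i))
  AllPairs-lookup R-sym (_  ∷ pxs) {Fin.suc i} {Fin.suc j} i≢j = AllPairs-lookup R-sym pxs (i≢j ∘ cong Fin.suc)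

isPartitionOf : ∀ {lo n} (Ps : List (List ℤ)) → Unique (concat Ps) → All (λ P → ∃[ z ] z ∈ P) Ps →
                (∀ z → InInterval lo n z ⇔ z ∈ concat Ps) → IsPartitionOf lo n Ps
isPartitionOf Ps unique nonempty cover = record
  { blocks-unique   = λ i → All.lookup uniquePs (∈-lookup i)
  ; blocks-nonempty = λ i → All.lookup nonempty (∈-lookup i)
  ; disjoint        = λ i j i≢j z z∈i z∈j → AllPairs-lookup Disjoint.sym disjointPs i≢j (z∈i , z∈j)
  ; covers          = λ z → mk⇔ (∈-concat⁻ Ps ∘ to (cover z)) (from (cover z) ∘ ∈-concat⁺)
  }
  where
  uniquePs : All Unique Ps
  uniquePs = proj₁ (Unique-concat⁻ Ps unique)
  disjointPs : AllPairs Disjoint Ps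
  disjointPs = proj₂ (Unique-concat⁻ Ps unique)

progression : ℕ → ℕ → ℕ → List ℕ
progression b T zero    = []
progression b T (suc c) = b ∷ progression (b + T) T c

module _ (T : ℕ) where

  length-progression : ∀ b c → length (progression b T c) ≡ c
  length-progression b zero    = refl
  length-progression b (suc c) = cong suc (length-progression (b + T) c)

  progression-++ : ∀ b c d → progression b T (c + d) ≡ progression b T c ++ progression (b + c * T) T d
  progression-++ b zero    d = cong (λ x → progression x T d) (sym (+-identityʳ b))
  progression-++ b (suc c) d = cong (b ∷_) (trans (progression-++ (b + T) c d)
    (cong (λ x → progression (b + T) T c ++ progression x T d) (+-assoc b T (c * T))))

  ∈-progression⁺ : ∀ {b c t} → t < c → b + t * T ∈ progression b T c
  ∈-progression⁺ {b} {suc c} {zero}  _         = here (+-identityʳ b)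
  ∈-progression⁺ {b} {suc c} {suc t} (s<s t<c) =
    there (subst (_∈ progression (b + T) T c) (+-assoc b T (t * T)) (∈-progression⁺ t<c))

  ∈-progression⁻ : ∀ {b c u} → u ∈ progression b T c → ∃[ t ] (t < c × u ≡ b + t * T)
  ∈-progression⁻ {b} {suc c} (here refl) = 0 , z<s , sym (+-identityʳ b)
  ∈-progression⁻ {b} {suc c} (there u∈) with ∈-progression⁻ u∈
  ... | t , t<c , refl = suc t , s<s t<c , +-assoc b T (t * T)

  module _ .{{_ : NonZero T}} where

    progression-unique : ∀ b c → Unique (progression b T c)
    progression-unique b zero    = []
    progression-unique b (suc c) = All.tabulate b∉ ∷ progression-unique (b + T) c
      where
      b∉ : ∀ {u} → u ∈ progression (b + T) T c → b ≢ u
      b∉ u∈ refl with ∈-progression⁻ u∈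
      ... | t , _ , b≡ = <⇒≢ (<-≤-trans (m<m+n b (>-nonZero⁻¹ T)) (m≤m+n (b + T) (t * T))) b≡

    ∈-progression⇔ : ∀ {b c u} → u ∈ progression b T (suc c) ⇔ (b ≤ u × u ≤ b + c * T × T ∣ℕ u ∸ b)
    ∈-progression⇔ {b} {c} {u} = mk⇔ ⇒ ⇐
      where
      ⇒ : u ∈ progression b T (suc c) → b ≤ u × u ≤ b + c * T × T ∣ℕ u ∸ b
      ⇒ u∈ with ∈-progression⁻ u∈
      ... | t , s≤s t≤c , refl = m≤m+n b (t * T) , +-monoʳ-≤ b (*-monoˡ-≤ T t≤c) ,
                                 subst (T ∣ℕ_) (sym (m+n∸m≡n b (t * T))) (n∣m*n t)
      ⇐ : b ≤ u × u ≤ b + c * T × T ∣ℕ u ∸ b → u ∈ progression b T (suc c)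
      ⇐ (b≤u , u≤ , divides q u∸b≡) = subst (_∈ progression b T (suc c)) u≡ (∈-progression⁺ (s≤s q≤c))
        where
        u≡ : b + q * T ≡ u
        u≡ = trans (cong (b +_) (sym u∸b≡)) (m+[n∸m]≡n b≤u)
        q≤c : q ≤ c
        q≤c = *-cancelʳ-≤ q c T (+-cancelˡ-≤ b _ _ (subst (_≤ b + c * T) (sym u≡) u≤))

sum-replicate : ∀ p k → sum (replicate p k) ≡ p * k
sum-replicate zero    k = refl
sum-replicate (suc p) k = cong (k +_) (sum-replicate p k)

composition : ∀ k m .{{_ : NonZero k}} → List ℕ
composition k m = k + m % k ∷ replicate (m / k ∸ 1) k

composition-bounded : ∀ k m .{{_ : NonZero k}} → All (λ c → k ≤ c × c < k + k) (composition k m)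
composition-bounded k m =
  (m≤m+n k (m % k) , +-monoʳ-< k (m%n<n m k)) ∷ All.replicate⁺ _ (≤-refl , m<m+n k (>-nonZero⁻¹ k))

sum-composition : ∀ k m .{{_ : NonZero k}} → k ≤ m → sum (composition k m) ≡ m
sum-composition k m k≤m with m / k in m/k≡ | m≥n⇒m/n>0 {m} {k} k≤m
... | suc p | _ = begin
  (k + m % k) + sum (replicate p k) ≡⟨ cong ((k + m % k) +_) (sum-replicate p k) ⟩
  (k + m % k) + p * k               ≡⟨ cong (_+ p * k) (+-comm k (m % k)) ⟩
  (m % k + k) + p * k               ≡⟨ +-assoc (m % k) k (p * k) ⟩
  m % k + suc p * k                 ≡⟨ cong (λ q → m % k + q * k) m/k≡ ⟨
  m % k + (m / k) * k               ≡⟨ m≡m%n+[m/n]*n m k ⟨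
  m                                 ∎
  where open ≡-Reasoning

n≤⌈n/2⌉+⌈n/2⌉ : ∀ n → n ≤ ⌈ n /2⌉ + ⌈ n /2⌉
n≤⌈n/2⌉+⌈n/2⌉ n = begin
  n                     ≡⟨ ⌊n/2⌋+⌈n/2⌉≡n n ⟨
  ⌊ n /2⌋ + ⌈ n /2⌉     ≤⟨ +-monoˡ-≤ ⌈ n /2⌉ (⌊n/2⌋≤⌈n/2⌉ n) ⟩
  ⌈ n /2⌉ + ⌈ n /2⌉     ∎
  where open ≤-Reasoning

⌈n/2⌉+⌈n/2⌉≤1+n : ∀ n → ⌈ n /2⌉ + ⌈ n /2⌉ ≤ suc n
⌈n/2⌉+⌈n/2⌉≤1+n zero          = z≤n
⌈n/2⌉+⌈n/2⌉≤1+n (suc zero)    = ≤-refl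
⌈n/2⌉+⌈n/2⌉≤1+n (suc (suc n)) = s≤s (≤-trans (≤-reflexive (+-suc ⌈ n /2⌉ ⌈ n /2⌉)) (s≤s (⌈n/2⌉+⌈n/2⌉≤1+n n)))

⌈n/2⌉≤c<2⌈n/2⌉⇒n≤2c∧c≤n : ∀ {n c} → ⌈ n /2⌉ ≤ c × c < ⌈ n /2⌉ + ⌈ n /2⌉ → n ≤ 2 * c × c ≤ n
⌈n/2⌉≤c<2⌈n/2⌉⇒n≤2c∧c≤n {n} {c} (k≤c , c<2k) =
  ≤-trans (n≤⌈n/2⌉+⌈n/2⌉ n)
          (subst (⌈ n /2⌉ + ⌈ n /2⌉ ≤_) (cong (c +_) (sym (+-identityʳ c))) (+-mono-≤ k≤c k≤c)) ,
  s≤s⁻¹ (≤-trans c<2k (⌈n/2⌉+⌈n/2⌉≤1+n n))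

chunks : ℕ → ℕ → List ℕ → List (List ℕ)
chunks b T []       = []
chunks b T (c ∷ cs) = progression b T c ∷ chunks (b + c * T) T cs

concat-chunks : ∀ b T cs → concat (chunks b T cs) ≡ progression b T (sum cs)
concat-chunks b T []       = refl
concat-chunks b T (c ∷ cs) =
  trans (cong (progression b T c ++_) (concat-chunks (b + c * T) T cs)) (sym (progression-++ T b c (sum cs)))

All-chunks : ∀ {p} {P : List ℕ → Set p} {T cs} → All (λ c → ∀ b → P (progression b T c)) cs →
             ∀ b → All P (chunks b T cs)
All-chunks []         b = []
All-chunks (Pc ∷ Pcs) b = Pc b ∷ All-chunks Pcs _

initialSegment : ∀ {p} {P : ℕ → Set p} → Decidable P → (∀ {s t} → s ≤ t → P t → P s) →
                 ∀ N → ¬ P N → ∃[ m ] (∀ t → t < m ⇔ P t)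
initialSegment P? downClosed zero ¬P0 =
  0 , λ t → mk⇔ (λ ()) (λ Pt → ⊥-elim (¬P0 (downClosed z≤n Pt)))
initialSegment P? downClosed (suc N) ¬P[1+N] with P? N
... | no ¬PN = initialSegment P? downClosed N ¬PN
... | yes PN = suc N , λ t → mk⇔ (λ t<1+N → downClosed (s≤s⁻¹ t<1+N) PN)
                                 (λ Pt → ≰⇒> (λ 1+N≤t → ¬P[1+N] (downClosed 1+N≤t Pt)))

module ResidueClasses (n T : ℕ) .{{_ : NonZero T}} where

  private
    size : ∀ j → ∃[ m ] (∀ t → t < m ⇔ j + t * T < n)
    size j = initialSegment (λ t → j + t * T <? n)
      (λ s≤t → ≤-<-trans (+-monoʳ-≤ j (*-monoˡ-≤ T s≤t))) n
      (λ j+nT<n → <⇒≱ j+nT<n (≤-trans (m≤m*n n T) (m≤n+m (n * T) j)))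

  classSize : ℕ → ℕ
  classSize j = proj₁ (size j)

  classSize-spec : ∀ j t → t < classSize j ⇔ j + t * T < n
  classSize-spec j = proj₂ (size j)

  residueClass : ℕ → List ℕ
  residueClass j = progression j T (classSize j)

  ∈-residueClass⇔ : ∀ {j u} → j < T → u ∈ residueClass j ⇔ (u < n × u % T ≡ j)
  ∈-residueClass⇔ {j} {u} j<T = mk⇔ ⇒ ⇐
    where
    ⇒ : u ∈ residueClass j → u < n × u % T ≡ j
    ⇒ u∈ with ∈-progression⁻ T u∈
    ... | t , t<m , refl = to (classSize-spec j t) t<m , trans ([m+kn]%n≡m%n j t T) (m<n⇒m%n≡m j<T)
    ⇐ : u < n × u % T ≡ j → u ∈ residueClass j
    ⇐ (u<n , refl) =
      subst (_∈ residueClass j) (sym u≡)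
            (∈-progression⁺ T (from (classSize-spec j (u / T)) (subst (_< n) u≡ u<n)))
      where
      u≡ : u ≡ u % T + (u / T) * T
      u≡ = m≡m%n+[m/n]*n u T

  residueClasses : List (List ℕ)
  residueClasses = map residueClass (upTo T)

  ∈-residueClasses⇔ : ∀ {u} → u ∈ concat residueClasses ⇔ u < n
  ∈-residueClasses⇔ {u} = mk⇔ ⇒ ⇐
    where
    ⇒ : u ∈ concat residueClasses → u < n
    ⇒ u∈ with ∈-concat⁻′ residueClasses u∈
    ... | xs , u∈xs , xs∈ with ∈-map⁻ residueClass xs∈
    ... | j , j∈ , refl = proj₁ (to (∈-residueClass⇔ (∈-upTo⁻ j∈)) u∈xs)
    ⇐ : u < n → u ∈ concat residueClasses
    ⇐ u<n = ∈-concat⁺′ (from (∈-residueClass⇔ u%T<T) (u<n , refl)) (∈-map⁺ residueClass (∈-upTo⁺ u%T<T))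
      where
      u%T<T : u % T < T
      u%T<T = m%n<n u T

  residueClasses-unique : Unique (concat residueClasses)
  residueClasses-unique = Unique.concat⁺
    (All.map⁺ (All.applyUpTo⁺₁ id T (λ _ → progression-unique T _ _)))
    (AllPairs.map⁺ (AllPairs.applyUpTo⁺₁ id T disjoint))
    where
    disjoint : ∀ {i j} → i < j → j < T → Disjoint (residueClass i) (residueClass j)
    disjoint {i} {j} i<j j<T {u} (u∈i , u∈j) = <⇒≢ i<j (trans (sym u%T≡i) u%T≡j)
      where
      u%T≡i : u % T ≡ i
      u%T≡i = proj₂ (to (∈-residueClass⇔ (<-trans i<j j<T)) u∈i)
      u%T≡j : u % T ≡ j
      u%T≡j = proj₂ (to (∈-residueClass⇔ j<T) u∈j)

  V≤classSize : ∀ {V j} → T * V ≤ n → j < T → V ≤ classSize j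
  V≤classSize {zero}   _    _   = z≤n
  V≤classSize {suc V′} {j} TV≤n j<T = from (classSize-spec j V′) (begin-strict
    j + V′ * T   <⟨ +-monoˡ-< (V′ * T) j<T ⟩
    suc V′ * T   ≡⟨ *-comm (suc V′) T ⟩
    T * suc V′   ≤⟨ TV≤n ⟩
    n            ∎)
    where open ≤-Reasoning

IsProgressionBlock : ℕ → ℕ → List ℕ → Set
IsProgressionBlock T V Q = ∃[ b ] ∃[ c ] (Q ≡ progression b T c × V ≤ 2 * c × c ≤ V)

progressionPartition : ∀ n T V .{{_ : NonZero T}} → 1 ≤ V → T * V ≤ n →
  ∃[ Qs ] (Unique (concat Qs) × (∀ u → u ∈ concat Qs ⇔ u < n) × All (IsProgressionBlock T V) Qs)
progressionPartition n T zero      () _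
progressionPartition n T V@(suc _) _  TV≤n =
  Qs , subst Unique (sym concat-Qs) residueClasses-unique ,
  (λ u → subst (λ us → u ∈ us ⇔ u < n) (sym concat-Qs) ∈-residueClasses⇔) ,
  All.concat⁺ (All.map⁺ (All.applyUpTo⁺₁ id T (λ {j} _ → blocksOf j)))
  where
  open ResidueClasses n T

  k : ℕ
  k = ⌈ V /2⌉

  chunksOf : ℕ → List (List ℕ)
  chunksOf j = chunks j T (composition k (classSize j))

  Qs : List (List ℕ)
  Qs = concat (map chunksOf (upTo T))

  concat-chunksOf : ∀ {j} → j < T → concat (chunksOf j) ≡ residueClass j
  concat-chunksOf {j} j<T = trans (concat-chunks j T (composition k (classSize j)))
    (cong (progression j T) (sum-composition k (classSize j) (≤-trans (⌈n/2⌉≤n V) (V≤classSize TV≤n j<T))))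

  concat-Qs : concat Qs ≡ concat residueClasses
  concat-Qs = begin
    concat (concat (map chunksOf (upTo T)))      ≡⟨ concat-concat (map chunksOf (upTo T)) ⟨
    concat (map concat (map chunksOf (upTo T)))  ≡⟨ cong concat (map-∘ (upTo T)) ⟨
    concat (map (concat ∘ chunksOf) (upTo T))
      ≡⟨ cong concat (map-cong-local (All.applyUpTo⁺₁ id T concat-chunksOf)) ⟩
    concat residueClasses                        ∎
    where open ≡-Reasoning

  blocksOf : ∀ j → All (IsProgressionBlock T V) (chunksOf j)
  blocksOf j = All-chunks (All.map toBlock (composition-bounded k (classSize j))) j
    where
    toBlock : ∀ {c} → k ≤ c × c < k + k → ∀ b → IsProgressionBlock T V (progression b T c)
    toBlock {c} bounds b = b , c , refl , ⌈n/2⌉≤c<2⌈n/2⌉⇒n≤2c∧c≤n bounds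

ℤ-cancelˡ : ∀ a x → ℤ.- a ℤ.+ (a ℤ.+ x) ≡ x
ℤ-cancelˡ = solve-∀

ℤ-[a+x]-[a+y] : ∀ a x y → (a ℤ.+ x) ℤ.- (a ℤ.+ y) ≡ x ℤ.- y
ℤ-[a+x]-[a+y] = solve-∀

ℤ-a+[z-a] : ∀ a z → a ℤ.+ (z ℤ.- a) ≡ z
ℤ-a+[z-a] = solve-∀

module Shift (lo : ℤ) where

  ι : ℕ → ℤ
  ι u = lo ℤ.+ ℤ.+ u

  ι-mono-≤ : ∀ {u v} → u ≤ v → ι u ℤ.≤ ι v
  ι-mono-≤ u≤v = ℤ.+-monoʳ-≤ lo (ℤ.+≤+ u≤v)

  ι-mono-< : ∀ {u v} → u < v → ι u ℤ.< ι v
  ι-mono-< u<v = ℤ.+-monoʳ-< lo (ℤ.+<+ u<v)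

  ι-cancel-≤ : ∀ {u v} → ι u ℤ.≤ ι v → u ≤ v
  ι-cancel-≤ {u} {v} ιu≤ιv =
    ℤ.drop‿+≤+ (subst₂ ℤ._≤_ (ℤ-cancelˡ lo (ℤ.+ u)) (ℤ-cancelˡ lo (ℤ.+ v)) (ℤ.+-monoʳ-≤ (ℤ.- lo) ιu≤ιv))

  ι-cancel-< : ∀ {u v} → ι u ℤ.< ι v → u < v
  ι-cancel-< {u} {v} ιu<ιv =
    ℤ.drop‿+<+ (subst₂ ℤ._<_ (ℤ-cancelˡ lo (ℤ.+ u)) (ℤ-cancelˡ lo (ℤ.+ v)) (ℤ.+-monoʳ-< (ℤ.- lo) ιu<ιv))

  ι-injective : ∀ {u v} → ι u ≡ ι v → u ≡ v
  ι-injective {u} {v} ιu≡ιv =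
    ℤ.+-injective (trans (sym (ℤ-cancelˡ lo (ℤ.+ u)))
                         (trans (cong (ℤ._+_ (ℤ.- lo)) ιu≡ιv) (ℤ-cancelˡ lo (ℤ.+ v))))

  ι-surjective : ∀ {z} → lo ℤ.≤ z → ∃[ u ] (z ≡ ι u)
  ι-surjective {z} lo≤z =
    ℤ.∣ z ℤ.- lo ∣ , sym (trans (cong (ℤ._+_ lo) (ℤ.0≤i⇒+∣i∣≡i (ℤ.i≤j⇒0≤j-i lo≤z))) (ℤ-a+[z-a] lo z))

  ∣ι-ι∣ : ∀ {u v} → v ≤ u → ℤ.∣ ι u ℤ.- ι v ∣ ≡ u ∸ v
  ∣ι-ι∣ {u} {v} v≤u = cong ℤ.∣_∣ (begin
    ι u ℤ.- ι v       ≡⟨ ℤ-[a+x]-[a+y] lo (ℤ.+ u) (ℤ.+ v) ⟩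
    ℤ.+ u ℤ.- ℤ.+ v   ≡⟨ ℤ.m-n≡m⊖n u v ⟩
    u ℤ.⊖ v           ≡⟨ ℤ.⊖-≥ v≤u ⟩
    ℤ.+ (u ∸ v)       ∎)
    where open ≡-Reasoning

  lo≤ι : ∀ u → lo ℤ.≤ ι u
  lo≤ι u = subst (ℤ._≤ ι u) (ℤ.+-identityʳ lo) (ι-mono-≤ z≤n)

  ι∈I⇔ : ∀ {n u} → InInterval lo n (ι u) ⇔ u < n
  ι∈I⇔ {u = u} = mk⇔ (ι-cancel-< ∘ proj₂) (λ u<n → lo≤ι u , ι-mono-< u<n)

  module _ {n T : ℕ} .{{_ : NonZero T}} where

    isAPBlock-progression : ∀ {b c} → b + c * T < n → IsAPBlock lo n T (map ι (progression b T (suc c)))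
    isAPBlock-progression {b} {c} last<n =
      ι b , ι b , ι (b + c * T) , from ι∈I⇔ (≤-<-trans (m≤m+n b (c * T)) last<n) , from ι∈I⇔ last<n ,
      λ z → mk⇔ ⇒ ⇐
      where
      ⇒ : ∀ {z} → z ∈ map ι (progression b T (suc c)) → InAPSegment T (ι b) (ι b) (ι (b + c * T)) z
      ⇒ z∈ with ∈-map⁻ ι z∈
      ... | u , u∈ , refl with to (∈-progression⇔ T) u∈
      ... | b≤u , u≤ , T∣u-b = ι-mono-≤ b≤u , ι-mono-≤ u≤ , subst (T ∣ℕ_) (sym (∣ι-ι∣ b≤u)) T∣u-b
      ⇐ : ∀ {z} → InAPSegment T (ι b) (ι b) (ι (b + c * T)) z → z ∈ map ι (progression b T (suc c))
      ⇐ (ιb≤z , z≤ , T∣z-ιb) with ι-surjective (ℤ.≤-trans (lo≤ι b) ιb≤z)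
      ... | u , refl =
        ∈-map⁺ ι (from (∈-progression⇔ T) (b≤u , ι-cancel-≤ z≤ , subst (T ∣ℕ_) (∣ι-ι∣ b≤u) T∣z-ιb))
        where
        b≤u : b ≤ u
        b≤u = ι-cancel-≤ ιb≤z

    shiftBlock : ∀ {V Q} → 1 ≤ V → IsProgressionBlock T V Q → (∀ {u} → u ∈ Q → u < n) →
                 (IsAPBlock lo n T (map ι Q) × V ≤ 2 * length (map ι Q) × length (map ι Q) ≤ V) ×
                 ∃[ z ] (z ∈ map ι Q)
    shiftBlock 1≤V (b , zero , refl , V≤0 , _) _ = ⊥-elim (<⇒≱ 1≤V V≤0)
    shiftBlock {V} 1≤V (b , suc c , refl , V≤2c , c≤V) Q<n =
      (isAPBlock-progression (Q<n (∈-progression⁺ T (n<1+n c))) ,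
       subst (λ l → V ≤ 2 * l) (sym length≡) V≤2c , subst (_≤ V) (sym length≡) c≤V) ,
      ι b , here refl
      where
      length≡ : length (map ι (progression b T (suc c))) ≡ suc c
      length≡ = trans (length-map ι (progression b T (suc c))) (length-progression T b (suc c))

    shiftPartition : ∀ {V} → 1 ≤ V → ∀ Qs → Unique (concat Qs) → (∀ u → u ∈ concat Qs ⇔ u < n) →
                     All (IsProgressionBlock T V) Qs →
                     IsPartitionOf lo n (map (map ι) Qs) ×
                     All (λ P → IsAPBlock lo n T P × V ≤ 2 * length P × length P ≤ V) (map (map ι) Qs)
    shiftPartition {V} 1≤V Qs unique cover blocks =
      isPartitionOf Ps unique-Ps (All.map proj₂ shifted) cover-Ps , All.map proj₁ shifted
      where
      Ps : List (List ℤ)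
      Ps = map (map ι) Qs

      concat-Ps : concat Ps ≡ map ι (concat Qs)
      concat-Ps = concat-map Qs

      unique-Ps : Unique (concat Ps)
      unique-Ps = subst Unique (sym concat-Ps) (Unique.map⁺ ι-injective unique)

      cover-Ps : ∀ z → InInterval lo n z ⇔ z ∈ concat Ps
      cover-Ps z = mk⇔ ⇒ ⇐
        where
        ⇒ : InInterval lo n z → z ∈ concat Ps
        ⇒ z∈I@(lo≤z , _) with ι-surjective lo≤z
        ... | u , refl = subst (ι u ∈_) (sym concat-Ps) (∈-map⁺ ι (from (cover u) (to ι∈I⇔ z∈I)))
        ⇐ : z ∈ concat Ps → InInterval lo n z
        ⇐ z∈ with ∈-map⁻ ι (subst (z ∈_) concat-Ps z∈)
        ... | u , u∈ , refl = from ι∈I⇔ (to (cover u) u∈)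

      shifted : All (λ P → (IsAPBlock lo n T P × V ≤ 2 * length P × length P ≤ V) × ∃[ z ] (z ∈ P)) Ps
      shifted = All.map⁺ (All.tabulate (λ Q∈ →
        shiftBlock 1≤V (All.lookup blocks Q∈) (λ u∈ → to (cover _) (∈-concat⁺′ u∈ Q∈))))

lemma5p1 : (lo : ℤ) (n : ℕ) (T V : ℕ) → 1 ≤ T → 1 ≤ V → T * V ≤ n →
    ∃[ Ps ] (IsPartitionOf lo n Ps ×
      (∀ (i : Fin (length Ps)) → IsAPBlock lo n T (lookup Ps i) ×
        (V ≤ 2 * length (lookup Ps i)) × (length (lookup Ps i) ≤ V)))
lemma5p1 lo n zero      V () _ _
lemma5p1 lo n T@(suc _) V _ 1≤V TV≤n with progressionPartition n T V 1≤V TV≤n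
... | Qs , unique , cover , blocks with Shift.shiftPartition lo 1≤V Qs unique cover blocks
... | partition , blocksℤ = map (map (Shift.ι lo)) Qs , partition , λ i → All.lookup blocksℤ (∈-lookup i)
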